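{- In intensional Martin-Löf type theory with weak propositional truncation, assume function extensionality. Let $Q,R:\mathcal U$ be propositions, let $Y:\mathcal U$, and let $f:Q+R\to Y$ be weakly constant, i.e. $\prod_{x,y:Q+R}f(x)=f(y)$. Then $f$ factors through $\lVert Q+R\rVert$: there is $\bar f:\lVert Q+R\rVert\to Y$ with $\prod_{x:Q+R}\bar f(|x|)=f(x)$.
   Context: Intensional Martin-Löf type theory with a universe $\mathcal U$, $\Sigma$, $\Pi$, $+$ and identity types (J only; no UIP/K). $\mathrm{isProp}(A):\equiv\prod_{a,b:A}a=b$; a proposition is a type $A$ with $\mathrm{isProp}(A)$. Weak propositional truncation: for every $A:\mathcal U$ a type $\lVert A\rVert:\mathcal U$ with $|{ - }|:A\to\lVert A\rVert$, a proof of $\mathrm{isProp}(\lVert A\rVert)$, and $\mathrm{rec}:\prod_{P:\mathcal U}\mathrm{isProp}(P)\to(A\to P)\to\lVert A\rVert\to P$ (no judgmental computation rule). Function extensionality: for $f,g:\prod_{x:X}B(x)$, $(\prod_{x}f(x)=g(x))\to f=g$. -}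

{-# OPTIONS --without-K #-}
module Defs where

open import Level using (0ℓ)
open import Data.Sum using (_⊎_)
open import Relation.Binary.PropositionalEquality using (_≡_)

-- The universe 𝒰 is Set (= Set 0ℓ).

isProp : Set → Set
isProp A = (a b : A) → a ≡ b

wconst : {X Y : Set} → (X → Y) → Set
wconst {X} f = (x y : X) → f x ≡ f y

FunExt : Set₁
FunExt = {X : Set} {B : X → Set} {f g : (x : X) → B x} →
         ((x : X) → f x ≡ g x) → f ≡ g

-- Weak propositional truncation: a type former with |_|, propositionality,
-- and a non-dependent recursor into propositions (no computation rule).
record WeakTrunc : Set₁ where
  field
    ∥_∥     : Set → Set
    ∣_∣     : {A : Set} → A → ∥ A ∥
    ∥∥-prop : {A : Set} → isProp ∥ A ∥
    rec     : {A : Set} (P : Set) → isProp P → (A → P) → ∥ A ∥ → P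

{-# OPTIONS --without-K #-}
-- The truncation only eliminates into propositions, so we eliminate into the
-- proposition (by function extensionality) that the type of coherent values is
-- contractible: a y : Y with paths h q : y ≡ f (inj₁ q) and k r : y ≡ f (inj₂ r)
-- such that every triangle h q · f-const (inj₁ q) (inj₂ r) ≡ k r commutes.
-- Without the triangles this type need not be a proposition. Given q₀ : Q, all
-- of h is determined by h q₀ because Q is a proposition; contracting h q₀ to
-- refl then leaves the singletons Σ k. (c ≡ k), one for each r. Given r₀ : R
-- the same happens with the roles swapped, the triangles now forcing each h q
-- to be the inverse of the constancy path. The map fbar sends z to the y of the
-- centre, and the legs of that centre give fbar ∣ x ∣ ≡ f x.
module Submission where

open import Defs
open import Axiom.UniquenessOfIdentityProofs using (UIP; module Constant⇒UIP)
open import Data.Product using (Σ; _,_; proj₁; proj₂)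
open import Data.Product.Properties using (Σ-≡,≡→≡)
open import Data.Sum using (_⊎_; inj₁; inj₂)
open import Relation.Binary.PropositionalEquality using (_≡_; refl; sym; trans; cong; subst)
open import Relation.Binary.PropositionalEquality.Properties using (dcong; trans-symˡ)

isContr : Set → Set
isContr A = Σ A λ c → (x : A) → c ≡ x

isContr⇒isProp : {A : Set} → isContr A → isProp A
isContr⇒isProp (c , h) x y = trans (sym (h x)) (h y)

isProp⇒UIP : {A : Set} → isProp A → UIP A
isProp⇒UIP p = Constant⇒UIP.≡-irrelevant (λ {x} {y} _ → p x y) (λ _ _ → refl)

isProp-isContr : FunExt → {A : Set} → isProp (isContr A)
isProp-isContr fe (c , h) (c' , h') =
  Σ-≡,≡→≡ (h c' , fe λ x → isProp⇒UIP (isContr⇒isProp (c , h)) _ _)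

isContr-singleton : {A : Set} (a : A) → isContr (Σ A λ x → a ≡ x)
isContr-singleton a = (a , refl) , λ { (_ , refl) → refl }

isContr-Π : FunExt → {A : Set} {B : A → Set} →
            ((x : A) → isContr (B x)) → isContr ((x : A) → B x)
isContr-Π fe c = (λ x → proj₁ (c x)) , λ g → fe λ x → proj₂ (c x) (g x)

isContr-inverses : {A : Set} {x z : A} (w : x ≡ z) → isContr (Σ (z ≡ x) λ h → trans h w ≡ refl)
isContr-inverses w = (sym w , trans-symˡ w) , contraction w
  where
  contraction : {A : Set} {x z : A} (w : x ≡ z) (p : Σ (z ≡ x) λ h → trans h w ≡ refl) →
                (sym w , trans-symˡ w) ≡ p
  contraction w (refl , refl) = refl

isContr-Σ-pathsTo : {Y : Set} (y₀ : Y) (B : (y : Y) → y ≡ y₀ → Set) →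
                    isContr (B y₀ refl) → isContr (Σ Y λ y → Σ (y ≡ y₀) (B y))
isContr-Σ-pathsTo y₀ B (b₀ , contract) =
  (y₀ , refl , b₀) , λ { (_ , refl , b) → cong (λ b → y₀ , refl , b) (contract b) }

record _◁_ (A B : Set) : Set where
  field
    section            : A → B
    retraction         : B → A
    retraction∘section : (a : A) → retraction (section a) ≡ a
open _◁_

◁-trans : {A B C : Set} → A ◁ B → B ◁ C → A ◁ C
◁-trans AB BC = record
  { section    = λ a → section BC (section AB a)
  ; retraction = λ c → retraction AB (retraction BC c)
  ; retraction∘section = λ a →
      trans (cong (retraction AB) (retraction∘section BC (section AB a))) (retraction∘section AB a)
  }

isContr-◁ : {A B : Set} → A ◁ B → isContr B → isContr A
isContr-◁ AB (b₀ , contract) =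
  retraction AB b₀ , λ a →
    trans (cong (retraction AB) (contract (section AB a))) (retraction∘section AB a)

Σ-◁ : {A : Set} {B C : A → Set} → ((x : A) → B x ◁ C x) → Σ A B ◁ Σ A C
Σ-◁ BC = record
  { section    = λ (x , b) → x , section (BC x) b
  ; retraction = λ (x , c) → x , retraction (BC x) c
  ; retraction∘section = λ (x , b) → cong (x ,_) (retraction∘section (BC x) b)
  }

Π-◁-at : FunExt → {X : Set} {D : X → Set} → isProp X → (x₀ : X) → ((x : X) → D x) ◁ D x₀
Π-◁-at fe {D = D} X-prop x₀ = record
  { section    = λ g → g x₀
  ; retraction = λ d x → subst D (X-prop x₀ x) d
  ; retraction∘section = λ g → fe λ x → dcong g (X-prop x₀ x)
  }

-- The legs to b come first, so that for a pointed proposition Q the product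
-- over Q is outermost in what follows them.
Cone : {Q R Y : Set} (a : Q → Y) (b : R → Y) →
       ({y : Y} (q : Q) (r : R) → y ≡ a q → y ≡ b r → Set) → Set
Cone {Q} {R} {Y} a b E =
  Σ Y λ y → Σ ((r : R) → y ≡ b r) λ k → (q : Q) → Σ (y ≡ a q) λ h → (r : R) → E q r h (k r)

isContr-Cone : FunExt → {Q R Y : Set} {a : Q → Y} {b : R → Y}
               (E : {y : Y} (q : Q) (r : R) → y ≡ a q → y ≡ b r → Set) →
               isProp Q → (q₀ : Q) → isContr ((r : R) → Σ (a q₀ ≡ b r) (E q₀ r refl)) →
               isContr (Cone a b E)
isContr-Cone fe {Q} {R} {Y} {a} {b} E Q-prop q₀ base =
  isContr-◁ (◁-trans (Σ-◁ λ _ → Σ-◁ λ _ → Π-◁-at fe Q-prop q₀) regroup)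
            (isContr-Σ-pathsTo (a q₀) _ base)
  where
  regroup : (Σ Y λ y → Σ ((r : R) → y ≡ b r) λ k → Σ (y ≡ a q₀) λ h → (r : R) → E q₀ r h (k r))
          ◁ (Σ Y λ y → Σ (y ≡ a q₀) λ h → (r : R) → Σ (y ≡ b r) (E q₀ r h))
  regroup = record
    { section    = λ (y , k , h , e) → y , h , λ r → k r , e r
    ; retraction = λ (y , h , φ) → y , (λ r → proj₁ (φ r)) , h , λ r → proj₂ (φ r)
    ; retraction∘section = λ _ → refl
    }

module CoherentValues {Q R Y : Set} (a : Q → Y) (b : R → Y) (c : (q : Q) (r : R) → a q ≡ b r) where

  Commutes : {y : Y} (q : Q) (r : R) → y ≡ a q → y ≡ b r → Set
  Commutes q r h k = trans h (c q r) ≡ k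

  CoherentValue : Set
  CoherentValue = Cone a b Commutes

  CoherentValue-≡ˡ : (w : CoherentValue) (q : Q) → proj₁ w ≡ a q
  CoherentValue-≡ˡ (_ , _ , φ) q = proj₁ (φ q)

  CoherentValue-≡ʳ : (w : CoherentValue) (r : R) → proj₁ w ≡ b r
  CoherentValue-≡ʳ (_ , k , _) = k

  isContr-CoherentValueˡ : FunExt → isProp Q → Q → isContr CoherentValue
  isContr-CoherentValueˡ fe Q-prop q₀ =
    isContr-Cone fe Commutes Q-prop q₀ (isContr-Π fe λ r → isContr-singleton (c q₀ r))

  isContr-CoherentValueʳ : FunExt → isProp R → R → isContr CoherentValue
  isContr-CoherentValueʳ fe R-prop r₀ =
    isContr-◁ swap (isContr-Cone fe (λ r q k h → Commutes q r h k) R-prop r₀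
                     (isContr-Π fe λ q → isContr-inverses (c q r₀)))
    where
    swap : CoherentValue ◁ Cone b a λ r q k h → Commutes q r h k
    swap = record
      { section    = λ (y , k , φ) → y , (λ q → proj₁ (φ q)) , λ r → k r , λ q → proj₂ (φ q) r
      ; retraction = λ (y , h , ψ) → y , (λ r → proj₁ (ψ r)) , λ q → h q , λ r → proj₂ (ψ r) q
      ; retraction∘section = λ _ → refl
      }

theorem5p5 : (T : WeakTrunc) → FunExt → (Q R Y : Set) → isProp Q → isProp R → (f : Q ⊎ R → Y) → wconst f → Σ (WeakTrunc.∥_∥ T (Q ⊎ R) → Y) (λ fbar → (x : Q ⊎ R) → fbar (WeakTrunc.∣_∣ T x) ≡ f x)
theorem5p5 T fe Q R Y Q-prop R-prop f f-const = fbar , fbar-∣∣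
  where
  open WeakTrunc T
  open CoherentValues (λ q → f (inj₁ q)) (λ r → f (inj₂ r)) (λ q r → f-const (inj₁ q) (inj₂ r))

  isContr-CoherentValue : ∥ Q ⊎ R ∥ → isContr CoherentValue
  isContr-CoherentValue = rec (isContr CoherentValue) (isProp-isContr fe) λ
    { (inj₁ q) → isContr-CoherentValueˡ fe Q-prop q
    ; (inj₂ r) → isContr-CoherentValueʳ fe R-prop r
    }

  fbar : ∥ Q ⊎ R ∥ → Y
  fbar z = proj₁ (proj₁ (isContr-CoherentValue z))

  fbar-∣∣ : (x : Q ⊎ R) → fbar ∣ x ∣ ≡ f x
  fbar-∣∣ (inj₁ q) = CoherentValue-≡ˡ (proj₁ (isContr-CoherentValue ∣ inj₁ q ∣)) q
  fbar-∣∣ (inj₂ r) = CoherentValue-≡ʳ (proj₁ (isContr-CoherentValue ∣ inj₂ r ∣)) r
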